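{- Let $S$ be a string whose first character $\sharp$ and last character $\$$ each occur nowhere else in $S$. Then $\mathsf{MRW}(S)\setminus\mathsf{EBF}(S)=\mathsf{MAW}(S)$; equivalently, $\mathsf{MRW}(S)\cap\mathsf{EBF}(S)=\bigcup_{k\ge1}\mathsf{MRW}_k(S)$.
   Context: Strings are over an alphabet $\Sigma$ (containing $\sharp$ and $\$$). $\mathrm{occ}_S(w)$ is the number of occurrences of $w$ in $S$, with $\mathrm{occ}_S(\varepsilon)=|S|+1$; $\mathrm{Substr}(S)$ is the set of substrings of $S$. $\mathsf{MAW}(S)$ is the set of strings $aub$ ($a,b\in\Sigma$, $u\in\Sigma^*$) with $\mathrm{occ}_S(aub)=0$, $\mathrm{occ}_S(au)\ge1$, $\mathrm{occ}_S(ub)\ge1$. $\mathsf{MRW}(S)$ (non-trivial minimal rare words) is the set of strings $aub$ ($a,b\in\Sigma$, $u\in\Sigma^*$) with $\mathrm{occ}_S(au)>\mathrm{occ}_S(aub)$ and $\mathrm{occ}_S(ub)>\mathrm{occ}_S(aub)$; $\mathsf{MRW}_k(S)=\{w\in\mathsf{MRW}(S): \mathrm{occ}_S(w)=k\}$. $\mathsf{EBF}(S)$ is the set of strings $aub\in\mathrm{Substr}(S)$ ($a,b\in\Sigma$, $u\in\Sigma^*$) such that $a'u\in\mathrm{Substr}(S)$ for some character $a'\ne a$ and $ub'\in\mathrm{Substr}(S)$ for some character $b'\ne b$. -}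

module Defs where

open import Data.Nat using (ℕ; zero; suc; _+_; _≥_; _>_)
open import Data.List using (List; []; _∷_; _++_; [_]; length)
open import Data.Product using (Σ-syntax; ∃-syntax; _×_)
open import Relation.Binary.PropositionalEquality using (_≡_; _≢_)
open import Relation.Binary.Definitions using (DecidableEquality)
open import Relation.Nullary using (¬_; yes; no)

module Strings {Σ : Set} (_≟_ : DecidableEquality Σ) where

  isPrefix : List Σ → List Σ → ℕ
  isPrefix []       _        = 1
  isPrefix (_ ∷ _)  []       = 0
  isPrefix (a ∷ w)  (c ∷ s) with a ≟ c
  ... | yes _ = isPrefix w s
  ... | no  _ = 0

  -- occ w S : number of positions i ∈ {0,…,|S|} such that w starts at i in S.
  -- In particular occ [] S = |S| + 1.
  occ : List Σ → List Σ → ℕ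
  occ w []       = isPrefix w []
  occ w (c ∷ s)  = isPrefix w (c ∷ s) + occ w s

  Substr : List Σ → List Σ → Set
  Substr S w = ∃[ x ] ∃[ y ] (x ++ w ++ y ≡ S)

  MAW : List Σ → List Σ → Set
  MAW S w = Σ[ a ∈ Σ ] Σ[ u ∈ List Σ ] Σ[ b ∈ Σ ]
              (w ≡ a ∷ u ++ [ b ]
              × occ w S ≡ 0
              × occ (a ∷ u) S ≥ 1
              × occ (u ++ [ b ]) S ≥ 1)

  MRW : List Σ → List Σ → Set
  MRW S w = Σ[ a ∈ Σ ] Σ[ u ∈ List Σ ] Σ[ b ∈ Σ ]
              (w ≡ a ∷ u ++ [ b ]
              × occ (a ∷ u) S > occ w S
              × occ (u ++ [ b ]) S > occ w S)

  MRW-k : ℕ → List Σ → List Σ → Set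
  MRW-k k S w = MRW S w × occ w S ≡ k

  EBF : List Σ → List Σ → Set
  EBF S w = Σ[ a ∈ Σ ] Σ[ u ∈ List Σ ] Σ[ b ∈ Σ ]
              (w ≡ a ∷ u ++ [ b ]
              × Substr S w
              × (∃[ a' ] (a' ≢ a × Substr S (a' ∷ u)))
              × (∃[ b' ] (b' ≢ b × Substr S (u ++ [ b' ]))))

-- Let w = a u b be a minimal rare word that occurs in S. Since au occurs more often than w,
-- some occurrence of au is not followed by b: either it is followed by some b' ≠ b, or it is
-- a suffix of S. A nonempty suffix of S ends with the unique letter $, so it cannot also occur
-- inside the occurrence of w (where it is followed by b); hence ub' occurs. Symmetrically, the
-- unique first letter ♯ yields some a' ≠ a with a'u occurring, so w is an extended bispecial
-- factor. Conversely, elements of EBF(S) occur in S, and the non-occurring minimal rare words are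
-- exactly the minimal absent words.
module Submission where

open import Defs
open import Data.Nat using (ℕ; _≥_)
open import Data.List using (List; _∷_; _++_; [_])
open import Data.List.Membership.Propositional using (_∉_)
open import Data.Product using (_×_; ∃-syntax)
open import Relation.Binary.PropositionalEquality using (_≡_)
open import Relation.Binary.Definitions using (DecidableEquality)
open import Relation.Nullary using (¬_)
open import Function.Bundles using (_⇔_)

open import Data.Nat using (_+_; _<_; _≤_; _<?_)
open import Data.Nat.Properties
  using (<⇒≱; ≮⇒≥; +-mono-≤; +-identityʳ; <-irrefl; <⇒≢; n≮0; m<n⇒0<n; m≤m+n; m≤n+m; ≤-refl; ≤-trans; ≤-reflexive; n≢0⇒n>0)
import Data.Nat.Properties as ℕ
open import Data.List using ([]; _∷ʳ_; initLast; _∷ʳ′_)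
open import Data.List.Properties using (∷-injective; ∷ʳ-injectiveʳ; ++-assoc; ++-identityʳ; ++-conicalʳ)
open import Data.List.Membership.Propositional using (_∈_)
open import Data.List.Membership.Propositional.Properties using (∈-++⁺ʳ)
open import Data.List.Relation.Unary.Any using (here; there)
open import Data.Product using (_,_; proj₁; proj₂; map₂)
open import Data.Sum using (_⊎_; inj₁; inj₂)
open import Data.Empty using (⊥-elim)
open import Relation.Binary.PropositionalEquality using (refl; sym; trans; cong; subst; _≢_)
open import Relation.Nullary using (yes; no)
open import Function.Bundles using (mk⇔; Equivalence)

m+n<o+p⇒m<o⊎n<p : ∀ {m n o p} → m + n < o + p → m < o ⊎ n < p
m+n<o+p⇒m<o⊎n<p {m} {n} {o} {p} m+n<o+p with m <? o | n <? p
... | yes m<o | _       = inj₁ m<o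
... | no _    | yes n<p = inj₂ n<p
... | no m≮o  | no n≮p  = ⊥-elim (<⇒≱ m+n<o+p (+-mono-≤ (≮⇒≥ m≮o) (≮⇒≥ n≮p)))

module _ {A : Set} where

  ∈-tail : ∀ {c a b : A} {T z} x → c ∷ T ≡ x ++ a ∷ b ∷ z → b ∈ T
  ∈-tail []      refl = here refl
  ∈-tail (_ ∷ x) refl = ∈-++⁺ʳ x (there (here refl))

  ∈-init : ∀ {d c b : A} {y} U x → U ∷ʳ d ≡ x ++ c ∷ b ∷ y → c ∈ U
  ∈-init []      []      ()
  ∈-init []      (_ ∷ x) eq with ++-conicalʳ x _ (sym (proj₂ (∷-injective eq)))
  ... | ()
  ∈-init (_ ∷ U) []      eq = here (sym (proj₁ (∷-injective eq)))
  ∈-init (_ ∷ U) (_ ∷ x) eq = there (∈-init U x (proj₂ (∷-injective eq)))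

  reoccurring-prefix≡[] : ∀ {♯ a : A} {T S r y} q x →
    ♯ ∉ T → S ≡ ♯ ∷ T → S ≡ q ++ r → S ≡ x ++ a ∷ q ++ y → q ≡ []
  reoccurring-prefix≡[] []      x _   _    _    _     = refl
  reoccurring-prefix≡[] (_ ∷ q) x ♯∉T refl refl S≡xaqy = ⊥-elim (♯∉T (∈-tail x S≡xaqy))

  reoccurring-suffix≡[] : ∀ {$ b : A} {U S x' y} x p →
    $ ∉ U → S ≡ U ∷ʳ $ → S ≡ x ++ p → S ≡ x' ++ p ++ b ∷ y → p ≡ []
  reoccurring-suffix≡[] {b = b} {U} {x' = x'} {y} x p $∉U refl S≡xp S≡x'pby with initLast p
  ... | [] = refl
  ... | q ∷ʳ′ l with ∷ʳ-injectiveʳ U (x ++ q) (trans S≡xp (sym (++-assoc x q [ l ])))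
  ...   | refl = ⊥-elim ($∉U (∈-init U (x' ++ q) (trans S≡x'pby x'qlby-assoc)))
    where
    x'qlby-assoc : x' ++ (q ∷ʳ l) ++ b ∷ y ≡ (x' ++ q) ++ l ∷ b ∷ y
    x'qlby-assoc = trans (cong (x' ++_) (++-assoc q [ l ] (b ∷ y))) (sym (++-assoc x' q (l ∷ b ∷ y)))

module _ {A : Set} (_≟_ : DecidableEquality A) where
  open Strings _≟_

  isPrefix-++ : ∀ w r → isPrefix w (w ++ r) ≡ 1
  isPrefix-++ []      r = refl
  isPrefix-++ (a ∷ w) r with a ≟ a
  ... | yes _  = isPrefix-++ w r
  ... | no a≢a = ⊥-elim (a≢a refl)

  isPrefix-++ˡ : ∀ w v s → isPrefix (w ++ v) (w ++ s) ≡ isPrefix v s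
  isPrefix-++ˡ []      v s = refl
  isPrefix-++ˡ (a ∷ w) v s with a ≟ a
  ... | yes _  = isPrefix-++ˡ w v s
  ... | no a≢a = ⊥-elim (a≢a refl)

  isPrefix>0⇒prefix : ∀ w s → 0 < isPrefix w s → ∃[ r ] s ≡ w ++ r
  isPrefix>0⇒prefix []      s       _ = s , refl
  isPrefix>0⇒prefix (_ ∷ _) []      ()
  isPrefix>0⇒prefix (a ∷ w) (c ∷ s) h with a ≟ c
  ... | yes refl = map₂ (cong (a ∷_)) (isPrefix>0⇒prefix w s h)
  ... | no _     = ⊥-elim (n≮0 h)

  isPrefix≤occ : ∀ w s → isPrefix w s ≤ occ w s
  isPrefix≤occ w []      = ≤-refl
  isPrefix≤occ w (c ∷ s) = m≤m+n _ _

  Substr⇒occ>0 : ∀ {S w} → Substr S w → 0 < occ w S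
  Substr⇒occ>0 {w = w} (x , y , refl) = occurs-in x
    where
    occurs-in : ∀ x → 0 < occ w (x ++ w ++ y)
    occurs-in []      = ≤-trans (≤-reflexive (sym (isPrefix-++ w y))) (isPrefix≤occ w (w ++ y))
    occurs-in (_ ∷ x) = ≤-trans (occurs-in x) (m≤n+m _ _)

  occ>0⇒Substr : ∀ w S → 0 < occ w S → Substr S w
  occ>0⇒Substr w []      h = let r , eq = isPrefix>0⇒prefix w [] h in [] , r , sym eq
  occ>0⇒Substr w (c ∷ s) h with m+n<o+p⇒m<o⊎n<p {0} {0} h
  ... | inj₁ h′ = let r , eq = isPrefix>0⇒prefix w (c ∷ s) h′ in [] , r , sym eq
  ... | inj₂ h′ = let x , y , eq = occ>0⇒Substr w s h′ in c ∷ x , y , cong (c ∷_) eq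

  Substr-++ˡ : ∀ {S} v {w} → Substr S (v ++ w) → Substr S v
  Substr-++ˡ v {w} (x , y , eq) = x , w ++ y , trans (cong (x ++_) (sym (++-assoc v w y))) eq

  Substr-++ʳ : ∀ {S} v {w} → Substr S (v ++ w) → Substr S w
  Substr-++ʳ v {w} (x , y , eq) =
    x ++ v , y , trans (++-assoc x v (w ++ y)) (trans (cong (x ++_) (sym (++-assoc v w y))) eq)

  occ-<⇒isPrefix-< : ∀ v w S → occ v S < occ w S →
    ∃[ x ] ∃[ t ] (S ≡ x ++ t × isPrefix v t < isPrefix w t)
  occ-<⇒isPrefix-< v w []      h = [] , [] , refl , h
  occ-<⇒isPrefix-< v w (c ∷ s) h with m+n<o+p⇒m<o⊎n<p h
  ... | inj₁ h′ = [] , c ∷ s , refl , h′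
  ... | inj₂ h′ with occ-<⇒isPrefix-< v w s h′
  ...   | x , t , refl , lt = c ∷ x , t , refl , lt

  -- An occurrence of a ∷ q is paired with the occurrence of q one position to its right.
  occ-∷-<⇒isPrefix-< : ∀ a q c s → occ (a ∷ q) (c ∷ s) < occ q s →
    ∃[ x ] ∃[ d ] ∃[ t ] (c ∷ s ≡ x ++ d ∷ t × isPrefix (a ∷ q) (d ∷ t) < isPrefix q t)
  occ-∷-<⇒isPrefix-< a q c []      h = [] , c , [] , refl , subst (_< isPrefix q []) (+-identityʳ _) h
  occ-∷-<⇒isPrefix-< a q c (e ∷ s) h with m+n<o+p⇒m<o⊎n<p h
  ... | inj₁ h′ = [] , c , e ∷ s , refl , h′
  ... | inj₂ h′ with occ-∷-<⇒isPrefix-< a q e s h′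
  ...   | x , d , t , eq , lt = c ∷ x , d , t , cong (c ∷_) eq , lt

  isPrefix-∷ʳ-< : ∀ p b t → isPrefix (p ++ [ b ]) t < isPrefix p t →
    t ≡ p ⊎ ∃[ b' ] ∃[ r ] (b' ≢ b × t ≡ p ++ b' ∷ r)
  isPrefix-∷ʳ-< p b t h with isPrefix>0⇒prefix p t (m<n⇒0<n h)
  ... | []    , refl = inj₁ (++-identityʳ p)
  ... | c ∷ r , refl with c ≟ b
  ...   | no c≢b  = inj₂ (c , r , c≢b , refl)
  ...   | yes refl = ⊥-elim (<-irrefl counts-agree h)
    where
    counts-agree : isPrefix (p ++ [ c ]) (p ++ c ∷ r) ≡ isPrefix p (p ++ c ∷ r)
    counts-agree = trans (trans (isPrefix-++ˡ p [ c ] (c ∷ r)) (isPrefix-++ [ c ] r)) (sym (isPrefix-++ p (c ∷ r)))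

  isPrefix-∷-< : ∀ a q d t → isPrefix (a ∷ q) (d ∷ t) < isPrefix q t → d ≢ a × ∃[ r ] t ≡ q ++ r
  isPrefix-∷-< a q d t h with isPrefix>0⇒prefix q t (m<n⇒0<n h)
  ... | r , refl = d≢a , r , refl
    where
    d≢a : d ≢ a
    d≢a refl = <-irrefl (trans (isPrefix-++ (d ∷ q) r) (sym (isPrefix-++ q r))) h

  right-context : ∀ p b S → occ (p ++ [ b ]) S < occ p S →
    (∃[ x ] S ≡ x ++ p) ⊎ (∃[ b' ] (b' ≢ b × Substr S (p ++ [ b' ])))
  right-context p b S h with occ-<⇒isPrefix-< (p ++ [ b ]) p S h
  ... | x , t , refl , lt with isPrefix-∷ʳ-< p b t lt
  ...   | inj₁ refl = inj₁ (x , refl)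
  ...   | inj₂ (b' , r , b'≢b , refl) = inj₂ (b' , b'≢b , x , r , cong (x ++_) (++-assoc p [ b' ] r))

  left-context : ∀ a q S → occ (a ∷ q) S < occ q S →
    (∃[ r ] S ≡ q ++ r) ⊎ (∃[ a' ] (a' ≢ a × Substr S (a' ∷ q)))
  left-context a q []      h = inj₁ (isPrefix>0⇒prefix q [] h)
  left-context a q (c ∷ s) h with m+n<o+p⇒m<o⊎n<p {0} h
  ... | inj₁ h′ = inj₁ (isPrefix>0⇒prefix q (c ∷ s) h′)
  ... | inj₂ h′ with occ-∷-<⇒isPrefix-< a q c s h′
  ...   | x , d , t , eq , lt with isPrefix-∷-< a q d t lt
  ...     | d≢a , r , refl = inj₂ (d , d≢a , x , r , sym eq)

  MRW⇒EBF : ∀ {♯ $ T U S w} → ♯ ∉ T → S ≡ ♯ ∷ T → $ ∉ U → S ≡ U ∷ʳ $ →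
    MRW S w → 0 < occ w S → EBF S w
  MRW⇒EBF {S = S} ♯∉T S≡♯T $∉U S≡U$ (a , u , b , refl , au>w , ub>w) w>0 =
    a , u , b , refl , occurrence , left , right
    where
    occurrence : Substr S (a ∷ u ++ [ b ])
    occurrence = occ>0⇒Substr _ S w>0
    x y : List A
    x = proj₁ occurrence
    y = proj₁ (proj₂ occurrence)
    S≡xwy : S ≡ x ++ (a ∷ u ++ [ b ]) ++ y
    S≡xwy = sym (proj₂ (proj₂ occurrence))

    u∷ʳb≢[] : u ∷ʳ b ≢ []
    u∷ʳb≢[] eq with ++-conicalʳ u [ b ] eq
    ... | ()

    left : ∃[ a' ] (a' ≢ a × Substr S (a' ∷ u))
    left with left-context a (u ++ [ b ]) S ub>w
    ... | inj₂ (a' , a'≢a , a'ub) = a' , a'≢a , Substr-++ˡ (a' ∷ u) a'ub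
    ... | inj₁ (_ , S≡ubr) = ⊥-elim (u∷ʳb≢[] (reoccurring-prefix≡[] (u ++ [ b ]) x ♯∉T S≡♯T S≡ubr S≡xwy))

    right : ∃[ b' ] (b' ≢ b × Substr S (u ++ [ b' ]))
    right with right-context (a ∷ u) b S au>w
    ... | inj₂ (b' , b'≢b , aub') = b' , b'≢b , Substr-++ʳ [ a ] aub'
    ... | inj₁ (x' , S≡x'au) = ⊥-elim (a∷u≢[] (reoccurring-suffix≡[] x' (a ∷ u) $∉U S≡U$ S≡x'au S≡xauby))
      where
      a∷u≢[] : a ∷ u ≢ []
      a∷u≢[] ()
      S≡xauby : S ≡ x ++ (a ∷ u) ++ b ∷ y
      S≡xauby = trans S≡xwy (cong (λ v → x ++ a ∷ v) (++-assoc u [ b ] y))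

  EBF⇒occ>0 : ∀ {S w} → EBF S w → 0 < occ w S
  EBF⇒occ>0 (_ , _ , _ , refl , occurrence , _) = Substr⇒occ>0 occurrence

  MAW⇔MRW×occ≡0 : ∀ {S w} → MAW S w ⇔ (MRW S w × occ w S ≡ 0)
  MAW⇔MRW×occ≡0 {S} = mk⇔
    (λ { (a , u , b , refl , w≡0 , au>0 , ub>0) →
           (a , u , b , refl , subst (_< occ (a ∷ u) S) (sym w≡0) au>0
                             , subst (_< occ (u ++ [ b ]) S) (sym w≡0) ub>0) , w≡0 })
    (λ { ((a , u , b , refl , au>w , ub>w) , w≡0) →
           a , u , b , refl , w≡0 , subst (_< occ (a ∷ u) S) w≡0 au>w
                                  , subst (_< occ (u ++ [ b ]) S) w≡0 ub>w })

lemma6 : {A : Set} (_≟_ : DecidableEquality A) (♯ $ : A) (S : List A)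
    → (∃[ T ] (S ≡ ♯ ∷ T × ♯ ∉ T))
    → (∃[ U ] (S ≡ U ++ [ $ ] × $ ∉ U))
    → (∀ w → (Strings.MRW _≟_ S w × ¬ Strings.EBF _≟_ S w) ⇔ Strings.MAW _≟_ S w)
      × (∀ w → (Strings.MRW _≟_ S w × Strings.EBF _≟_ S w)
               ⇔ (∃[ k ] (k ≥ 1 × Strings.MRW-k _≟_ k S w)))
lemma6 _≟_ ♯ $ S (T , S≡♯T , ♯∉T) (U , S≡U$ , $∉U) =
  (λ w → mk⇔ (to₁ w) (from₁ w)) , (λ w → mk⇔ (to₂ w) (from₂ w))
  where
  open Strings _≟_

  occurring-MRW⇒EBF : ∀ {w} → MRW S w → 0 < occ w S → EBF S w
  occurring-MRW⇒EBF = MRW⇒EBF _≟_ ♯∉T S≡♯T $∉U S≡U$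

  to₁ : ∀ w → MRW S w × ¬ EBF S w → MAW S w
  to₁ w (mrw , ¬ebf) with occ w S ℕ.≟ 0
  ... | yes w≡0 = Equivalence.from (MAW⇔MRW×occ≡0 _≟_ {S}) (mrw , w≡0)
  ... | no w≢0  = ⊥-elim (¬ebf (occurring-MRW⇒EBF mrw (n≢0⇒n>0 w≢0)))

  from₁ : ∀ w → MAW S w → MRW S w × ¬ EBF S w
  from₁ w maw with Equivalence.to (MAW⇔MRW×occ≡0 _≟_ {S}) maw
  ... | mrw , w≡0 = mrw , λ ebf → <⇒≢ (EBF⇒occ>0 _≟_ {S} ebf) (sym w≡0)

  to₂ : ∀ w → MRW S w × EBF S w → ∃[ k ] (k ≥ 1 × MRW-k k S w)
  to₂ w (mrw , ebf) = occ w S , EBF⇒occ>0 _≟_ {S} ebf , mrw , refl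

  from₂ : ∀ w → ∃[ k ] (k ≥ 1 × MRW-k k S w) → MRW S w × EBF S w
  from₂ w (k , k≥1 , mrw , w≡k) = mrw , occurring-MRW⇒EBF mrw (subst (0 <_) (sym w≡k) k≥1)
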